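{- Let $S$ be a complete folding sequence. Then for each integer $t\ge 7$, $S$ has exactly $4t$ distinct subwords of length $t$; and for $t=1,2,3,4,5,6$ the number of distinct subwords of length $t$ of $S$ is respectively $2,4,8,12,18,23$.
   Context: All sequences take values in $\{+1,-1\}$. For a finite sequence $S=(a_1,\dots,a_n)$ write $\overline{S}=(-a_n,\dots,-a_1)$. The $n$-folding sequences are defined recursively: the only $0$-folding sequence is the empty sequence, and the $(n+1)$-folding sequences are exactly $(\overline{S},+1,S)$ and $(\overline{S},-1,S)$ with $S$ an $n$-folding sequence. A finite sequence $(u_1,\dots,u_m)$ is a subword of a sequence $(b_k)$ if there is $h$ with $u_k=b_{k+h}$ for $1\le k\le m$. A finite folding sequence is a subword of some $n$-folding sequence. A complete folding sequence is a sequence $(a_k)_{k\in\mathbb{Z}}$ all of whose finite subwords are finite folding sequences. -}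

module Defs where

open import Data.Nat using (ℕ; zero; suc)
open import Data.Integer using (ℤ) renaming (suc to sucℤ)
open import Data.Sign using (Sign; opposite)
open import Data.List using (List; []; _∷_; _++_; reverse; map; length)
open import Data.List.Relation.Unary.Unique.Propositional using (Unique)
open import Data.List.Membership.Propositional using (_∈_)
open import Data.Product using (Σ; ∃; _×_)
open import Function.Bundles using (_⇔_)
open import Relation.Binary.PropositionalEquality using (_≡_)

-- Values ±1 are represented by Data.Sign.Sign (+ / -), negation is 'opposite'.

bar : List Sign → List Sign
bar S = reverse (map opposite S)

data IsFolding : ℕ → List Sign → Set where
  fold-zero : IsFolding zero []
  fold-suc  : ∀ {n S} (b : Sign) → IsFolding n S → IsFolding (suc n) (bar S ++ (b ∷ S))

SubwordOf : List Sign → List Sign → Set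
SubwordOf u b = ∃ λ xs → ∃ λ ys → b ≡ xs ++ u ++ ys

FiniteFolding : List Sign → Set
FiniteFolding u = ∃ λ n → ∃ λ S → IsFolding n S × SubwordOf u S

window : (ℤ → Sign) → ℤ → ℕ → List Sign
window a h zero    = []
window a h (suc m) = a h ∷ window a (sucℤ h) m

SubwordZ : List Sign → (ℤ → Sign) → Set
SubwordZ u a = ∃ λ h → u ≡ window a h (length u)

CompleteFolding : (ℤ → Sign) → Set
CompleteFolding a = ∀ u → SubwordZ u a → FiniteFolding u

SubwordCount : (ℤ → Sign) → ℕ → ℕ → Set
SubwordCount a t N =
  Σ (List (List Sign)) λ L →
    Unique L × length L ≡ N ×
    (∀ w → (w ∈ L) ⇔ (length w ≡ t × SubwordZ w a))

module Submission where

-- A folding sequence of level n+1 is (S̄, b, S); its entries at even positions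
-- alternate, those at odd positions form a folding sequence of level n
-- (folding-structure).  Hence a nonempty finite folding word splits by parity of
-- positions into an alternating word and a finite folding word
-- (finiteFolding-split), and a finite folding word of length ≥ 4 never alternates.
-- For a complete folding sequence a this singles out one parity class, the
-- anchors (recognised from any window of length 7), carrying ±(+,-,+,-,…), while
-- the other class carries again a complete folding sequence (unfold).  Every
-- window of a is thus a weave of an alternating word with a window of the derived
-- sequence, so the pairs (parity of start, word) are listed recursively by
-- `marks`: 4m of them for each length m ≥ 1, without repetition.  For t ≥ 7 the
-- word determines the parity, giving 4t subwords; for t ≤ 6 the count depends on
-- three unfolding parameters only and is evaluated for all 64 choices.

open import Defs
open import Data.Nat using (ℕ; zero; suc; _≤_; _*_; z≤n; s≤s; ⌊_/2⌋; ⌈_/2⌉)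
  renaming (_+_ to _+ℕ_)
open import Data.Nat.Properties
  using (≤-refl; ≤-trans; ≤-reflexive; suc-injective; m≤n+m; *-distribˡ-+;
         n≡⌊n+n/2⌋; ⌊n/2⌋≤n; ⌈n/2⌉≤n; ⌊n/2⌋+⌈n/2⌉≡n)
open import Data.Integer using (ℤ; +_; -[1+_]; 0ℤ; 1ℤ; -1ℤ; _+_; pred) renaming (suc to sucℤ)
open import Data.Integer.Properties using (pred-suc; suc-pred)
open import Data.Integer.Tactic.RingSolver using (solve-∀)
open import Data.Bool using (Bool; true; false; not; _xor_)
open import Data.Bool.Properties using (not-involutive; not-injective; not-¬; ¬-not; xor-identityʳ)
open import Data.Sign using (Sign; opposite) renaming (+ to ⊕; - to ⊖)
open import Data.Sign.Properties using (opposite-involutive; opposite-injective; s≢opposite[s])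
  renaming (_≟_ to _≟ˢ_)
open import Data.List using (List; []; _∷_; _++_; reverse; map; length; take; drop; deduplicate)
open import Data.List.Properties
  using (≡-dec; ∷-injectiveˡ; ++-assoc; ++-identityʳ; ++-conicalʳ; unfold-reverse;
         take++drop≡id; length-++; length-map)
open import Data.List.Relation.Unary.All as All using (All; []; _∷_)
import Data.List.Relation.Unary.All.Properties as All
open import Data.List.Relation.Unary.Any using (here; there)
open import Data.List.Relation.Unary.AllPairs using ([]; _∷_)
open import Data.List.Relation.Unary.Unique.Propositional using (Unique)
import Data.List.Relation.Unary.Unique.Propositional.Properties as Unique
import Data.List.Relation.Unary.Unique.DecPropositional.Properties as UniqueDec
open import Data.List.Membership.Propositional using (_∈_)
open import Data.List.Membership.Propositional.Properties
  using (∈-map⁺; ∈-map⁻; ∈-++⁺ˡ; ∈-++⁺ʳ; ∈-++⁻; deduplicate-∈⇔)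
open import Data.Product using (Σ; _×_; _,_; proj₁; proj₂)
open import Data.Sum using (_⊎_; inj₁; inj₂)
import Data.Sum as Sum
open import Data.Unit using (⊤; tt)
open import Data.Empty using (⊥; ⊥-elim)
open import Relation.Nullary using (¬_; Dec; yes; no; _×-dec_)
open import Relation.Binary.Definitions using (DecidableEquality)
open import Relation.Nullary.Decidable using (map′; toWitness)
import Data.Nat as ℕ
import Data.Bool as Bool
open import Function.Base using (_∘_; id)
open import Function.Properties.Equivalence using () renaming (sym to ⇔-sym; trans to ⇔-trans)
open import Function.Bundles using (_⇔_; mk⇔; Equivalence)
open import Relation.Binary.PropositionalEquality
  using (_≡_; refl; sym; trans; cong; cong₂; subst; module ≡-Reasoning)

private variable
  A B : Set

pick : Bool → List A → List A
pick _     []       = []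
pick false (x ∷ xs) = x ∷ pick true xs
pick true  (x ∷ xs) = pick false xs

oddLength : List A → Bool
oddLength []       = false
oddLength (_ ∷ xs) = not (oddLength xs)

pick-++ : (b : Bool) (xs ys : List A) →
          pick b (xs ++ ys) ≡ pick b xs ++ pick (b xor oddLength xs) ys
pick-++ b     []       ys rewrite xor-identityʳ b = refl
pick-++ false (x ∷ xs) ys = cong (x ∷_) (pick-++ true xs ys)
pick-++ true  (x ∷ xs) ys rewrite not-involutive (oddLength xs) = pick-++ false xs ys

pick-map : (f : A → B) (b : Bool) (xs : List A) → pick b (map f xs) ≡ map f (pick b xs)
pick-map f _     []       = refl
pick-map f false (x ∷ xs) = cong (f x ∷_) (pick-map f true xs)
pick-map f true  (x ∷ xs) = pick-map f false xs

oddLength-++ : (xs ys : List A) → oddLength (xs ++ ys) ≡ oddLength xs xor oddLength ys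
oddLength-++ []       ys = refl
oddLength-++ (x ∷ xs) ys rewrite oddLength-++ xs ys with oddLength xs
... | false = refl
... | true  = not-involutive _

oddLength-map : (f : A → B) (xs : List A) → oddLength (map f xs) ≡ oddLength xs
oddLength-map f []       = refl
oddLength-map f (x ∷ xs) = cong not (oddLength-map f xs)

oddLength-reverse : (xs : List A) → oddLength (reverse xs) ≡ oddLength xs
oddLength-reverse []       = refl
oddLength-reverse (x ∷ xs)
  rewrite unfold-reverse x xs | oddLength-++ (reverse xs) (x ∷ []) | oddLength-reverse xs
  with oddLength xs
... | false = refl
... | true  = refl

-- Reversal maps position i of xs to position (length xs - 1 - i), so it
-- preserves the parity of positions exactly when xs has odd length.
pick-reverse : (b : Bool) (xs : List A) →
               pick b (reverse xs) ≡ reverse (pick (b xor not (oddLength xs)) xs)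
pick-reverse b []       = refl
pick-reverse b (x ∷ xs) = begin
  pick b (reverse (x ∷ xs))
    ≡⟨ cong (pick b) (unfold-reverse x xs) ⟩
  pick b (reverse xs ++ x ∷ [])
    ≡⟨ pick-++ b (reverse xs) (x ∷ []) ⟩
  pick b (reverse xs) ++ pick (b xor oddLength (reverse xs)) (x ∷ [])
    ≡⟨ cong₂ _++_ (pick-reverse b xs)
                  (cong (λ o → pick (b xor o) (x ∷ [])) (oddLength-reverse xs)) ⟩
  reverse (pick (b xor not (oddLength xs)) xs) ++ pick (b xor oddLength xs) (x ∷ [])
    ≡⟨ last-entry b (oddLength xs) ⟩
  reverse (pick (b xor not (oddLength (x ∷ xs))) (x ∷ xs)) ∎
  where
  open ≡-Reasoning
  last-entry : ∀ c o → reverse (pick (c xor not o) xs) ++ pick (c xor o) (x ∷ []) ≡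
                       reverse (pick (c xor not (not o)) (x ∷ xs))
  last-entry false false = sym (unfold-reverse x (pick true xs))
  last-entry false true  = ++-identityʳ _
  last-entry true  false = ++-identityʳ _
  last-entry true  true  = sym (unfold-reverse x (pick true xs))

oddLength-bar : (S : List Sign) → oddLength (bar S) ≡ oddLength S
oddLength-bar S = trans (oddLength-reverse (map opposite S)) (oddLength-map opposite S)

pick-bar : (b : Bool) (S : List Sign) → oddLength S ≡ true → pick b (bar S) ≡ bar (pick b S)
pick-bar b S odd
  rewrite pick-reverse b (map opposite S) | oddLength-map opposite S | odd | xor-identityʳ b
  = cong reverse (pick-map opposite b S)

Alternating : List Sign → Set
Alternating []          = ⊤
Alternating (_ ∷ [])    = ⊤
Alternating (x ∷ y ∷ w) = y ≡ opposite x × Alternating (y ∷ w)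

alternating : Sign → ℕ → List Sign
alternating s zero    = []
alternating s (suc n) = s ∷ alternating (opposite s) n

alternating-alternates : ∀ s n → Alternating (alternating s n)
alternating-alternates s zero          = tt
alternating-alternates s (suc zero)    = tt
alternating-alternates s (suc (suc n)) = refl , alternating-alternates (opposite s) (suc n)

Alternating-++ˡ : ∀ xs ys → Alternating (xs ++ ys) → Alternating xs
Alternating-++ˡ []           ys _          = tt
Alternating-++ˡ (x ∷ [])     ys _          = tt
Alternating-++ˡ (x ∷ y ∷ xs) ys (y≡ , alt) = y≡ , Alternating-++ˡ (y ∷ xs) ys alt

Alternating-++ʳ : ∀ xs ys → Alternating (xs ++ ys) → Alternating ys
Alternating-++ʳ []           ys       alt     = alt
Alternating-++ʳ (x ∷ [])     []       _       = tt
Alternating-++ʳ (x ∷ [])     (y ∷ ys) (_ , alt) = alt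
Alternating-++ʳ (x ∷ y ∷ xs) ys       (_ , alt) = Alternating-++ʳ (y ∷ xs) ys alt

Alternating-subword : ∀ {u w} → SubwordOf u w → Alternating w → Alternating u
Alternating-subword {u} (xs , ys , refl) alt =
  Alternating-++ˡ u ys (Alternating-++ʳ xs (u ++ ys) alt)

Alternating-period : ∀ {x y z w} → Alternating (x ∷ y ∷ z ∷ w) → z ≡ x
Alternating-period {x} (y≡ , z≡ , _) = trans z≡ (trans (cong opposite y≡) (opposite-involutive x))

bar-∷ : ∀ x xs → bar (x ∷ xs) ≡ bar xs ++ opposite x ∷ []
bar-∷ x xs = unfold-reverse (opposite x) (map opposite xs)

-- Reflecting an alternating word x ∷ xs in front of x ∷ ys keeps alternation:
-- the junction reads  opposite x , x.
Alternating-reflect : ∀ x xs ys → Alternating (x ∷ xs) → Alternating (x ∷ ys) →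
                      Alternating (bar (x ∷ xs) ++ x ∷ ys)
Alternating-reflect x [] ys _ alt = sym (opposite-involutive x) , alt
Alternating-reflect x (x′ ∷ xs) ys (x′≡ , alt) alt′ =
  subst Alternating (sym junction) (Alternating-reflect x′ xs (x ∷ ys) alt (x≡ , alt′))
  where
  open ≡-Reasoning
  x≡ : x ≡ opposite x′
  x≡ = sym (trans (cong opposite x′≡) (opposite-involutive x))
  junction : bar (x ∷ x′ ∷ xs) ++ x ∷ ys ≡ bar (x′ ∷ xs) ++ x′ ∷ x ∷ ys
  junction = begin
    bar (x ∷ x′ ∷ xs) ++ x ∷ ys
      ≡⟨ cong (_++ x ∷ ys) (bar-∷ x (x′ ∷ xs)) ⟩
    (bar (x′ ∷ xs) ++ opposite x ∷ []) ++ x ∷ ys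
      ≡⟨ ++-assoc (bar (x′ ∷ xs)) (opposite x ∷ []) (x ∷ ys) ⟩
    bar (x′ ∷ xs) ++ opposite x ∷ x ∷ ys
      ≡⟨ cong (λ s → bar (x′ ∷ xs) ++ s ∷ x ∷ ys) (sym x′≡) ⟩
    bar (x′ ∷ xs) ++ x′ ∷ x ∷ ys ∎

-- The even part of a folding sequence (S̄, b, S) is (Ē, E) for the even part E of S.
Alternating-bar++ : ∀ E → Alternating E → Alternating (bar E ++ E)
Alternating-bar++ []       _   = tt
Alternating-bar++ (x ∷ xs) alt = Alternating-reflect x xs xs alt alt

xor-true : ∀ b → b xor true ≡ not b
xor-true false = refl
xor-true true  = refl

-- Picking positions from (S̄, c, S) for S of odd length: S̄ also has odd length,
-- so the parity of positions flips after it.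
pick-unfold : ∀ b c S → oddLength S ≡ true →
              pick b (bar S ++ c ∷ S) ≡ bar (pick b S) ++ pick (not b) (c ∷ S)
pick-unfold b c S odd = begin
  pick b (bar S ++ c ∷ S)
    ≡⟨ pick-++ b (bar S) (c ∷ S) ⟩
  pick b (bar S) ++ pick (b xor oddLength (bar S)) (c ∷ S)
    ≡⟨ cong₂ _++_ (pick-bar b S odd)
                  (cong (λ o → pick (b xor o) (c ∷ S)) (trans (oddLength-bar S) odd)) ⟩
  bar (pick b S) ++ pick (b xor true) (c ∷ S)
    ≡⟨ cong (λ d → bar (pick b S) ++ pick d (c ∷ S)) (xor-true b) ⟩
  bar (pick b S) ++ pick (not b) (c ∷ S) ∎
  where open ≡-Reasoning

folding-structure : ∀ {n S} → IsFolding (suc n) S →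
  Alternating (pick false S) × IsFolding n (pick true S) × oddLength S ≡ true
folding-structure (fold-suc b fold-zero) = tt , fold-zero , refl
folding-structure (fold-suc {S = S} b f@(fold-suc _ _)) with folding-structure f
... | alt , fold , odd =
  subst Alternating (sym (pick-unfold false b S odd)) (Alternating-bar++ (pick false S) alt) ,
  subst (IsFolding _) (sym (pick-unfold true b S odd)) (fold-suc b fold) ,
  oddness
  where
  oddness : oddLength (bar S ++ b ∷ S) ≡ true
  oddness rewrite oddLength-++ (bar S) (b ∷ S) | oddLength-bar S | odd = refl

pick-subword : ∀ b {u S} xs ys → S ≡ xs ++ u ++ ys →
               SubwordOf (pick (b xor oddLength xs) u) (pick b S)
pick-subword b {u} xs ys refl =
  pick b xs , pick _ ys ,
  trans (pick-++ b xs (u ++ ys)) (cong (pick b xs ++_) (pick-++ (b xor oddLength xs) u ys))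

finiteFolding-split : ∀ {x r} → FiniteFolding (x ∷ r) →
  Σ Bool λ d → Alternating (pick d (x ∷ r)) × FiniteFolding (pick (not d) (x ∷ r))
finiteFolding-split {x} {r} (zero , [] , fold-zero , xs , ys , eq) =
  ⊥-elim (nonempty (++-conicalʳ xs (x ∷ r ++ ys) (sym eq)))
  where
  nonempty : ∀ {zs : List Sign} → x ∷ zs ≡ [] → ⊥
  nonempty ()
finiteFolding-split (suc n , S , f , xs , ys , eq) with folding-structure f
... | alt , fold , _ =
  oddLength xs ,
  Alternating-subword (pick-subword false xs ys eq) alt ,
  (n , pick true S , fold , pick-subword true xs ys eq)

finiteFolding-notAlternating : ∀ {x₀ x₁ x₂ x₃ r} →
  FiniteFolding (x₀ ∷ x₁ ∷ x₂ ∷ x₃ ∷ r) → ¬ Alternating (x₀ ∷ x₁ ∷ x₂ ∷ x₃ ∷ r)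
finiteFolding-notAlternating {x₀} {x₁} ff alt with finiteFolding-split ff
... | false , (x₂≡ , _) , _ = s≢opposite[s] x₀ (trans (sym (Alternating-period alt)) x₂≡)
... | true  , (x₃≡ , _) , _ = s≢opposite[s] x₁ (trans (sym (Alternating-period (proj₂ alt))) x₃≡)

finiteFolding-prefix : ∀ xs ys → FiniteFolding (xs ++ ys) → FiniteFolding xs
finiteFolding-prefix xs ys (n , S , f , us , vs , eq) =
  n , S , f , us , ys ++ vs , trans eq (cong (us ++_) (++-assoc xs ys vs))

ℤ-induction : (P : ℤ → Set) → P 0ℤ → (∀ k → P k → P (sucℤ k)) → (∀ k → P (sucℤ k) → P k) →
              ∀ k → P k
ℤ-induction P p₀ up down (+ zero)     = p₀
ℤ-induction P p₀ up down (+ suc n)    = up (+ n) (ℤ-induction P p₀ up down (+ n))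
ℤ-induction P p₀ up down -[1+ zero ]  = down -[1+ zero ] p₀
ℤ-induction P p₀ up down -[1+ suc n ] = down -[1+ suc n ] (ℤ-induction P p₀ up down -[1+ n ])

sucℤ-injective : ∀ {k l} → sucℤ k ≡ sucℤ l → k ≡ l
sucℤ-injective {k} {l} eq = trans (sym (pred-suc k)) (trans (cong pred eq) (pred-suc l))

oddℕ : ℕ → Bool
oddℕ zero    = false
oddℕ (suc n) = not (oddℕ n)

parity : ℤ → Bool
parity (+ n)    = oddℕ n
parity -[1+ n ] = not (oddℕ n)

parity-suc : ∀ k → parity (sucℤ k) ≡ not (parity k)
parity-suc (+ n)          = refl
parity-suc -[1+ zero ]    = refl
parity-suc -[1+ suc n ]   = sym (not-involutive _)

bit : Bool → ℤ
bit false = 0ℤ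
bit true  = 1ℤ

parity-bit : ∀ p → parity (bit p) ≡ p
parity-bit false = refl
parity-bit true  = refl

position : Bool → ℤ → ℤ
position c j = bit c + (j + j)

position-suc : ∀ c j → position c (sucℤ j) ≡ sucℤ (sucℤ (position c j))
position-suc c j = shift (bit c) j
  where
  shift : ∀ x j → x + ((1ℤ + j) + (1ℤ + j)) ≡ 1ℤ + (1ℤ + (x + (j + j)))
  shift = solve-∀

parity-position : ∀ c j → parity (position c j) ≡ c
parity-position c = ℤ-induction (λ j → parity (position c j) ≡ c) (base c)
  (λ j eq → trans (sym (step j)) eq) (λ j eq → trans (step j) eq)
  where
  base : ∀ c → parity (position c 0ℤ) ≡ c
  base false = refl
  base true  = refl
  step : ∀ j → parity (position c j) ≡ parity (position c (sucℤ j))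
  step j = begin
    parity (position c j)                     ≡⟨ sym (not-involutive _) ⟩
    not (not (parity (position c j)))         ≡⟨ cong not (sym (parity-suc (position c j))) ⟩
    not (parity (sucℤ (position c j)))        ≡⟨ sym (parity-suc (sucℤ (position c j))) ⟩
    parity (sucℤ (sucℤ (position c j)))       ≡⟨ cong parity (sym (position-suc c j)) ⟩
    parity (position c (sucℤ j))              ∎
    where open ≡-Reasoning

position-cover : ∀ c k → Σ ℤ λ j → k ≡ position c j ⊎ k ≡ sucℤ (position c j)
position-cover c = ℤ-induction Covered (base c) up down
  where
  Covered : ℤ → Set
  Covered k = Σ ℤ λ j → k ≡ position c j ⊎ k ≡ sucℤ (position c j)
  base : ∀ c → Σ ℤ λ j → 0ℤ ≡ position c j ⊎ 0ℤ ≡ sucℤ (position c j)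
  base false = 0ℤ , inj₁ refl
  base true  = -1ℤ , inj₂ refl
  up : ∀ k → Covered k → Covered (sucℤ k)
  up k (j , inj₁ eq) = j , inj₂ (cong sucℤ eq)
  up k (j , inj₂ eq) = sucℤ j , inj₁ (trans (cong sucℤ eq) (sym (position-suc c j)))
  down : ∀ k → Covered (sucℤ k) → Covered k
  down k (j , inj₂ eq) = j , inj₁ (sucℤ-injective eq)
  down k (j , inj₁ eq) = pred j , inj₂ (sucℤ-injective (begin
    sucℤ k                            ≡⟨ eq ⟩
    position c j                      ≡⟨ cong (position c) (sym (suc-pred j)) ⟩
    position c (sucℤ (pred j))        ≡⟨ position-suc c (pred j) ⟩
    sucℤ (sucℤ (position c (pred j))) ∎))
    where open ≡-Reasoning

signed : Sign → Bool → Sign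
signed e false = e
signed e true  = opposite e

signed-not : ∀ e p → signed e (not p) ≡ opposite (signed e p)
signed-not e false = refl
signed-not e true  = sym (opposite-involutive e)

signed-injective : ∀ e {p q} → signed e p ≡ signed e q → p ≡ q
signed-injective e {false} {false} _  = refl
signed-injective e {true}  {true}  _  = refl
signed-injective e {false} {true}  eq = ⊥-elim (s≢opposite[s] e eq)
signed-injective e {true}  {false} eq = ⊥-elim (s≢opposite[s] e (sym eq))

signed-surjective : ∀ e s → Σ Bool λ p → signed e p ≡ s
signed-surjective ⊕ ⊕ = false , refl
signed-surjective ⊕ ⊖ = true  , refl
signed-surjective ⊖ ⊖ = false , refl
signed-surjective ⊖ ⊕ = true  , refl

-- weave₀ s v m is the word of length m carrying the alternating word from s at
-- its even positions and v at its odd positions; weave₁ s v m carries v at the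
-- even and the alternating word from s at the odd positions.
weave₀ weave₁ : Sign → List Sign → ℕ → List Sign
weave₀ s v       zero    = []
weave₀ s v       (suc m) = s ∷ weave₁ (opposite s) v m
weave₁ s v       zero    = []
weave₁ s []      (suc m) = []
weave₁ s (x ∷ v) (suc m) = x ∷ weave₀ s v m

pick-weave₀ : ∀ m s v → length v ≡ ⌊ m /2⌋ →
              pick false (weave₀ s v m) ≡ alternating s ⌈ m /2⌉ × pick true (weave₀ s v m) ≡ v
pick-weave₁ : ∀ m s v → length v ≡ ⌈ m /2⌉ →
              pick false (weave₁ s v m) ≡ v × pick true (weave₁ s v m) ≡ alternating s ⌊ m /2⌋
pick-weave₀ zero    s [] _   = refl , refl
pick-weave₀ (suc m) s v  len = cong (s ∷_) (proj₂ (pick-weave₁ m (opposite s) v len)) ,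
                               proj₁ (pick-weave₁ m (opposite s) v len)
pick-weave₁ zero    s []      _   = refl , refl
pick-weave₁ (suc m) s (x ∷ v) len = cong (x ∷_) (proj₂ (pick-weave₀ m s v (suc-injective len))) ,
                                    proj₁ (pick-weave₀ m s v (suc-injective len))

length-weave₀ : ∀ m s v → length v ≡ ⌊ m /2⌋ → length (weave₀ s v m) ≡ m
length-weave₁ : ∀ m s v → length v ≡ ⌈ m /2⌉ → length (weave₁ s v m) ≡ m
length-weave₀ zero    s v       _   = refl
length-weave₀ (suc m) s v       len = cong suc (length-weave₁ m (opposite s) v len)
length-weave₁ zero    s v       _   = refl
length-weave₁ (suc m) s (x ∷ v) len = cong suc (length-weave₀ m s v (suc-injective len))

length-window : ∀ a x n → length (window a x n) ≡ n
length-window a x zero    = refl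
length-window a x (suc n) = cong suc (length-window a (sucℤ x) n)

take-window : ∀ a x {m n} → m ≤ n → take m (window a x n) ≡ window a x m
take-window a x {zero}  _         = refl
take-window a x {suc m} (s≤s m≤n) = cong (a x ∷_) (take-window a (sucℤ x) m≤n)

derived : (ℤ → Sign) → Bool → ℤ → Sign
derived a c j = a (sucℤ (position c j))

module Weaving (a : ℤ → Sign) (c : Bool) (e : Sign)
               (value : ∀ j → a (position c j) ≡ signed e (parity j)) where

  window-even : ∀ m j → window a (position c j) m ≡
                weave₀ (signed e (parity j)) (window (derived a c) j ⌊ m /2⌋) m
  window-odd  : ∀ m j → window a (sucℤ (position c j)) m ≡
                weave₁ (signed e (not (parity j))) (window (derived a c) j ⌈ m /2⌉) m
  window-even zero    j = refl
  window-even (suc m) j = cong₂ _∷_ (value j) (begin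
    window a (sucℤ (position c j)) m
      ≡⟨ window-odd m j ⟩
    weave₁ (signed e (not (parity j))) (window (derived a c) j ⌈ m /2⌉) m
      ≡⟨ cong (λ s → weave₁ s (window (derived a c) j ⌈ m /2⌉) m) (signed-not e (parity j)) ⟩
    weave₁ (opposite (signed e (parity j))) (window (derived a c) j ⌈ m /2⌉) m ∎)
    where open ≡-Reasoning
  window-odd zero    j = refl
  window-odd (suc m) j = cong (a (sucℤ (position c j)) ∷_) (begin
    window a (sucℤ (sucℤ (position c j))) m
      ≡⟨ cong (λ x → window a x m) (sym (position-suc c j)) ⟩
    window a (position c (sucℤ j)) m
      ≡⟨ window-even m (sucℤ j) ⟩
    weave₀ (signed e (parity (sucℤ j))) (window (derived a c) (sucℤ j) ⌊ m /2⌋) m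
      ≡⟨ cong (λ p → weave₀ (signed e p) (window (derived a c) (sucℤ j) ⌊ m /2⌋) m) (parity-suc j) ⟩
    weave₀ (signed e (not (parity j))) (window (derived a c) (sucℤ j) ⌊ m /2⌋) m ∎)
    where open ≡-Reasoning

Anchor : (ℤ → Sign) → ℤ → Set
Anchor a x = Alternating (pick false (window a x 7))

record Unfolding (a : ℤ → Sign) : Set where
  field
    class           : Bool
    sign            : Sign
    anchor-iff      : ∀ k → Anchor a k ⇔ (parity k ≡ class)
    value           : ∀ j → a (position class j) ≡ signed sign (parity j)
    derivedComplete : CompleteFolding (derived a class)

module _ {a : ℤ → Sign} (complete : CompleteFolding a) where

  window-finiteFolding : ∀ x n → FiniteFolding (window a x n)
  window-finiteFolding x n =
    complete (window a x n) (x , cong (window a x) (sym (length-window a x n)))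

  -- Split the window of length 8 at x: its even part is the anchor condition at
  -- x and its odd part the anchor condition at x + 1.  One of them holds, and the
  -- other part, being finite folding of length 4, does not alternate.
  anchor-here-or-next : ∀ x → Anchor a x ⊎ Anchor a (sucℤ x)
  anchor-here-or-next x with finiteFolding-split (window-finiteFolding x 8)
  ... | false , alt , _ = inj₁ alt
  ... | true  , alt , _ = inj₂ alt

  not-consecutive-anchors : ∀ x → Anchor a x → ¬ Anchor a (sucℤ x)
  not-consecutive-anchors x at-x at-next with finiteFolding-split (window-finiteFolding x 8)
  ... | false , _ , ff = finiteFolding-notAlternating ff at-next
  ... | true  , _ , ff = finiteFolding-notAlternating ff at-x

  anchor-forward : ∀ x → Anchor a x → Anchor a (sucℤ (sucℤ x))
  anchor-forward x anc with anchor-here-or-next (sucℤ x)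
  ... | inj₁ at-next  = ⊥-elim (not-consecutive-anchors x anc at-next)
  ... | inj₂ at-next₂ = at-next₂

  anchor-backward : ∀ x → Anchor a (sucℤ (sucℤ x)) → Anchor a x
  anchor-backward x anc with anchor-here-or-next x
  ... | inj₁ at-x    = at-x
  ... | inj₂ at-next = ⊥-elim (not-consecutive-anchors (sucℤ x) at-next anc)

  module _ (c : Bool) (anchor₀ : Anchor a (position c 0ℤ)) where

    -- Anchors propagate in steps of 2, so all positions c + 2j are anchors ...
    anchors : ∀ j → Anchor a (position c j)
    anchors = ℤ-induction (λ j → Anchor a (position c j)) anchor₀
      (λ j anc → subst (Anchor a) (sym (position-suc c j)) (anchor-forward (position c j) anc))
      (λ j anc → anchor-backward (position c j) (subst (Anchor a) (position-suc c j) anc))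

    -- ... and no other position is, as c + 2j + 1 follows an anchor.
    anchors-exactly : ∀ k → Anchor a k ⇔ (parity k ≡ c)
    anchors-exactly k with position-cover c k
    ... | j , inj₁ refl = mk⇔ (λ _ → parity-position c j) (λ _ → anchors j)
    ... | j , inj₂ refl =
      mk⇔ (λ anc → ⊥-elim (not-consecutive-anchors _ (anchors j) anc))
          (λ eq → ⊥-elim (not-¬ (sym (parity-position c j))
                                (trans (sym eq) (parity-suc (position c j)))))

    values : ∀ j → a (position c j) ≡ signed (a (position c 0ℤ)) (parity j)
    values = ℤ-induction (λ j → a (position c j) ≡ signed e (parity j)) refl
      (λ j eq → trans (step j) (trans (cong opposite eq) (sym (signed-suc j))))
      (λ j eq → opposite-injective (trans (sym (step j)) (trans eq (signed-suc j))))
      where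
      e = a (position c 0ℤ)
      step : ∀ j → a (position c (sucℤ j)) ≡ opposite (a (position c j))
      step j = trans (cong a (position-suc c j)) (proj₁ (anchors j))
      signed-suc : ∀ j → signed e (parity (sucℤ j)) ≡ opposite (signed e (parity j))
      signed-suc j = trans (cong (signed e) (parity-suc j)) (signed-not e (parity j))

  -- The derived sequence is again complete folding: a window of it of length m is
  -- a prefix of the odd part of the window W of a of length n = 8 + 2m at c + 2h.
  -- The split of W cannot make its even part the folding one, since that part
  -- alternates and has length at least 4.
  derived-complete : ∀ c e → (∀ j → a (position c j) ≡ signed e (parity j)) →
                     CompleteFolding (derived a c)
  derived-complete c e value u (h , u≡) =
    subst FiniteFolding (sym u≡) (derived-window (length u))
    where
    open Weaving a c e value
    derived-window : ∀ m → FiniteFolding (window (derived a c) h m)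
    derived-window m = from-split (finiteFolding-split (window-finiteFolding (position c h) n))
      where
      n  = 8 +ℕ (m +ℕ m)
      W  = window a (position c h) n
      W′ = window (derived a c) h ⌊ n /2⌋
      σ  = signed e (parity h)
      parts : pick false W ≡ alternating σ ⌈ n /2⌉ × pick true W ≡ W′
      parts with pick-weave₀ n σ W′ (length-window (derived a c) h ⌊ n /2⌋)
      ... | even , odd = trans (cong (pick false) (window-even n h)) even ,
                         trans (cong (pick true) (window-even n h)) odd
      from-split : Σ Bool (λ d → Alternating (pick d W) × FiniteFolding (pick (not d) W)) →
                   FiniteFolding (window (derived a c) h m)
      from-split (true  , _ , ff) = ⊥-elim (finiteFolding-notAlternating
        (subst FiniteFolding (proj₁ parts) ff) (alternating-alternates σ ⌈ n /2⌉))
      from-split (false , _ , ff) =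
        subst FiniteFolding (take-window (derived a c) h m≤)
          (finiteFolding-prefix (take m W′) (drop m W′)
            (subst FiniteFolding (trans (proj₂ parts) (sym (take++drop≡id m W′))) ff))
        where
        m≤ : m ≤ ⌊ n /2⌋
        m≤ = ≤-trans (≤-reflexive (n≡⌊n+n/2⌋ m)) (m≤n+m _ 4)

  unfolding-at : ∀ c → Anchor a (position c 0ℤ) → Unfolding a
  unfolding-at c anc = record
    { class           = c
    ; sign            = a (position c 0ℤ)
    ; anchor-iff      = anchors-exactly c anc
    ; value           = values c anc
    ; derivedComplete = derived-complete c _ (values c anc)
    }

  unfold : Unfolding a
  unfold with anchor-here-or-next 0ℤ
  ... | inj₁ anc = unfolding-at false anc
  ... | inj₂ anc = unfolding-at true anc

next-complete : ∀ {a} (complete : CompleteFolding a) →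
                CompleteFolding (derived a (Unfolding.class (unfold complete)))
next-complete complete = Unfolding.derivedComplete (unfold complete)

Param : Set
Param = Bool × Sign

unfoldings : (a : ℤ → Sign) → CompleteFolding a → ℕ → Param
unfoldings a complete zero    = Unfolding.class U , Unfolding.sign U
  where U = unfold complete
unfoldings a complete (suc i) =
  unfoldings (derived a (Unfolding.class (unfold complete))) (next-complete complete) i

-- A mark (p , w) records a word w together with the parity p of a position
-- where it starts.
Mark : Set
Mark = Bool × List Sign

Occurrence : (ℤ → Sign) → ℕ → Mark → Set
Occurrence a m (p , w) = Σ ℤ λ k → parity k ≡ p × w ≡ window a k m

-- Given an occurrence of v at parity p in the derived sequence, the words starting
-- at the corresponding positions c + 2j and c + 2j + 1 of a.
extend₀ extend₁ : Param → ℕ → Mark → Mark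
extend₀ (c , e) m (p , v) = c     , weave₀ (signed e p) v m
extend₁ (c , e) m (p , v) = not c , weave₁ (signed e (not p)) v m

-- marks n P m lists the marks of length m of a complete folding sequence whose
-- successive unfoldings have parameters P: the letters for m = 1, and for m ≥ 2
-- the extensions of the marks of the derived sequence (n bounds the recursion).
marks : ℕ → (ℕ → Param) → ℕ → List Mark
marks n       P zero = (false , []) ∷ (true , []) ∷ []
marks n       P (suc zero) =
  (false , ⊕ ∷ []) ∷ (false , ⊖ ∷ []) ∷ (true , ⊕ ∷ []) ∷ (true , ⊖ ∷ []) ∷ []
marks zero    P (suc (suc m)) = []
marks (suc n) P (suc (suc m)) =
  map (extend₀ (P 0) (suc (suc m))) (marks n (P ∘ suc) ⌊ suc (suc m) /2⌋) ++
  map (extend₁ (P 0) (suc (suc m))) (marks n (P ∘ suc) ⌈ suc (suc m) /2⌉)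

halves-fit : ∀ {m n} → suc (suc m) ≤ suc n → ⌊ suc (suc m) /2⌋ ≤ n × ⌈ suc (suc m) /2⌉ ≤ n
halves-fit {m} (s≤s m+1≤n) = ≤-trans (s≤s (⌊n/2⌋≤n m)) m+1≤n , ≤-trans (s≤s (⌈n/2⌉≤n m)) m+1≤n

-- There are 4m marks of length m ≥ 1: recursively 4⌊m/2⌋ + 4⌈m/2⌉.
marks-length : ∀ n P m → 1 ≤ m → m ≤ n → length (marks n P m) ≡ 4 * m
marks-length n       P (suc zero)    _ _  = refl
marks-length (suc n) P (suc (suc m)) _ le = begin
  length (map (extend₀ (P 0) M) G₀ ++ map (extend₁ (P 0) M) G₁)
    ≡⟨ length-++ (map (extend₀ (P 0) M) G₀) ⟩
  length (map (extend₀ (P 0) M) G₀) +ℕ length (map (extend₁ (P 0) M) G₁)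
    ≡⟨ cong₂ _+ℕ_ (length-map (extend₀ (P 0) M) G₀) (length-map (extend₁ (P 0) M) G₁) ⟩
  length G₀ +ℕ length G₁
    ≡⟨ cong₂ _+ℕ_ (marks-length n (P ∘ suc) ⌊ M /2⌋ (s≤s z≤n) (proj₁ (halves-fit le)))
                  (marks-length n (P ∘ suc) ⌈ M /2⌉ (s≤s z≤n) (proj₂ (halves-fit le))) ⟩
  4 * ⌊ M /2⌋ +ℕ 4 * ⌈ M /2⌉
    ≡⟨ sym (*-distribˡ-+ 4 ⌊ M /2⌋ ⌈ M /2⌉) ⟩
  4 * (⌊ M /2⌋ +ℕ ⌈ M /2⌉)
    ≡⟨ cong (4 *_) (⌊n/2⌋+⌈n/2⌉≡n M) ⟩
  4 * M ∎
  where
  open ≡-Reasoning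
  M  = suc (suc m)
  G₀ = marks n (P ∘ suc) ⌊ M /2⌋
  G₁ = marks n (P ∘ suc) ⌈ M /2⌉

marks-wordLength : ∀ n P m → m ≤ n → All (λ q → length (proj₂ q) ≡ m) (marks n P m)
marks-wordLength n       P zero          _  = refl ∷ refl ∷ []
marks-wordLength n       P (suc zero)    _  = refl ∷ refl ∷ refl ∷ refl ∷ []
marks-wordLength (suc n) P (suc (suc m)) le =
  All.++⁺ (All.map⁺ (All.map (λ {q} → length-weave₀ M _ (proj₂ q))
                             (marks-wordLength n (P ∘ suc) ⌊ M /2⌋ (proj₁ (halves-fit le)))))
          (All.map⁺ (All.map (λ {q} → length-weave₁ M _ (proj₂ q))
                             (marks-wordLength n (P ∘ suc) ⌈ M /2⌉ (proj₂ (halves-fit le)))))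
  where M = suc (suc m)

Unique-map : ∀ (f : A → B) {xs} → (∀ {x y} → x ∈ xs → y ∈ xs → f x ≡ f y → x ≡ y) →
             Unique xs → Unique (map f xs)
Unique-map f {[]}     _   []         = []
Unique-map f {x ∷ xs} inj (x∉ ∷ uniq) =
  All.map⁺ (All.tabulate λ y∈ fx≡fy → All.lookup x∉ y∈ (inj (here refl) (there y∈) fx≡fy)) ∷
  Unique-map f (λ x∈ y∈ → inj (there x∈) (there y∈)) uniq

-- extend₀ recovers the word as the odd part and the parity from the first letter.
extend₀-injective : ∀ P m {q q′} → length (proj₂ q) ≡ ⌊ suc (suc m) /2⌋ →
  length (proj₂ q′) ≡ ⌊ suc (suc m) /2⌋ →
  extend₀ P (suc (suc m)) q ≡ extend₀ P (suc (suc m)) q′ → q ≡ q′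
extend₀-injective (c , e) m {p , v} {p′ , v′} len len′ eq =
  cong₂ _,_ (signed-injective e (∷-injectiveˡ words≡)) (begin
    v                                                 ≡⟨ sym (proj₂ (pick-weave₀ M _ v len)) ⟩
    pick true (weave₀ (signed e p) v M)               ≡⟨ cong (pick true) words≡ ⟩
    pick true (weave₀ (signed e p′) v′ M)             ≡⟨ proj₂ (pick-weave₀ M _ v′ len′) ⟩
    v′                                                ∎)
  where
  open ≡-Reasoning
  M = suc (suc m)
  words≡ = cong proj₂ eq

-- extend₁ recovers the word as the even part and the parity from the second letter.
extend₁-injective : ∀ P m {q q′} → length (proj₂ q) ≡ ⌈ suc (suc m) /2⌉ →
  length (proj₂ q′) ≡ ⌈ suc (suc m) /2⌉ →
  extend₁ P (suc (suc m)) q ≡ extend₁ P (suc (suc m)) q′ → q ≡ q′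
extend₁-injective (c , e) m {p , v} {p′ , v′} len len′ eq =
  cong₂ _,_ (not-injective (signed-injective e (∷-injectiveˡ odd≡))) (begin
    v                                                 ≡⟨ sym (proj₁ (pick-weave₁ M _ v len)) ⟩
    pick false (weave₁ (signed e (not p)) v M)        ≡⟨ cong (pick false) words≡ ⟩
    pick false (weave₁ (signed e (not p′)) v′ M)      ≡⟨ proj₁ (pick-weave₁ M _ v′ len′) ⟩
    v′                                                ∎)
  where
  open ≡-Reasoning
  M = suc (suc m)
  words≡ = cong proj₂ eq
  odd≡ : alternating (signed e (not p)) ⌊ M /2⌋ ≡ alternating (signed e (not p′)) ⌊ M /2⌋
  odd≡ = trans (sym (proj₂ (pick-weave₁ M _ v len)))
               (trans (cong (pick true) words≡) (proj₂ (pick-weave₁ M _ v′ len′)))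

marks-unique : ∀ n P m → m ≤ n → Unique (marks n P m)
marks-unique n       P zero          _  = ((λ ()) ∷ []) ∷ [] ∷ []
marks-unique n       P (suc zero)    _  =
  ((λ ()) ∷ (λ ()) ∷ (λ ()) ∷ []) ∷ ((λ ()) ∷ (λ ()) ∷ []) ∷ ((λ ()) ∷ []) ∷ [] ∷ []
marks-unique (suc n) P (suc (suc m)) le =
  Unique.++⁺ (Unique-map (extend₀ (P 0) M) injective₀ (marks-unique n (P ∘ suc) ⌊ M /2⌋ fit₀))
             (Unique-map (extend₁ (P 0) M) injective₁ (marks-unique n (P ∘ suc) ⌈ M /2⌉ fit₁))
             disjoint
  where
  M = suc (suc m)
  fit₀ = proj₁ (halves-fit le)
  fit₁ = proj₂ (halves-fit le)
  G₀ = marks n (P ∘ suc) ⌊ M /2⌋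
  G₁ = marks n (P ∘ suc) ⌈ M /2⌉
  injective₀ : ∀ {q q′} → q ∈ G₀ → q′ ∈ G₀ → extend₀ (P 0) M q ≡ extend₀ (P 0) M q′ → q ≡ q′
  injective₀ q∈ q′∈ = extend₀-injective (P 0) m
    (All.lookup (marks-wordLength n (P ∘ suc) ⌊ M /2⌋ fit₀) q∈)
    (All.lookup (marks-wordLength n (P ∘ suc) ⌊ M /2⌋ fit₀) q′∈)
  injective₁ : ∀ {q q′} → q ∈ G₁ → q′ ∈ G₁ → extend₁ (P 0) M q ≡ extend₁ (P 0) M q′ → q ≡ q′
  injective₁ q∈ q′∈ = extend₁-injective (P 0) m
    (All.lookup (marks-wordLength n (P ∘ suc) ⌈ M /2⌉ fit₁) q∈)
    (All.lookup (marks-wordLength n (P ∘ suc) ⌈ M /2⌉ fit₁) q′∈)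
  -- the two blocks differ in the parity of the mark
  disjoint : ∀ {q} → ¬ (q ∈ map (extend₀ (P 0) M) G₀ × q ∈ map (extend₁ (P 0) M) G₁)
  disjoint (q∈₀ , q∈₁) with ∈-map⁻ (extend₀ (P 0) M) q∈₀ | ∈-map⁻ (extend₁ (P 0) M) q∈₁
  ... | _ , _ , eq₀ | _ , _ , eq₁ = not-¬ refl (trans (sym (cong proj₁ eq₀)) (cong proj₁ eq₁))

empty-mark : ∀ {n P} p → (p , []) ∈ marks n P zero
empty-mark false = here refl
empty-mark true  = there (here refl)

letter-mark : ∀ {n P} p s → (p , s ∷ []) ∈ marks n P (suc zero)
letter-mark false ⊕ = here refl
letter-mark false ⊖ = there (here refl)
letter-mark true  ⊕ = there (there (here refl))
letter-mark true  ⊖ = there (there (there (here refl)))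

∈-marks⁺₀ : ∀ {n P m q} → q ∈ marks n (P ∘ suc) ⌊ suc (suc m) /2⌋ →
            extend₀ (P 0) (suc (suc m)) q ∈ marks (suc n) P (suc (suc m))
∈-marks⁺₀ mem = ∈-++⁺ˡ (∈-map⁺ _ mem)

∈-marks⁺₁ : ∀ {n P m q} → q ∈ marks n (P ∘ suc) ⌈ suc (suc m) /2⌉ →
            extend₁ (P 0) (suc (suc m)) q ∈ marks (suc n) P (suc (suc m))
∈-marks⁺₁ {n} {P} {m} mem =
  ∈-++⁺ʳ (map (extend₀ (P 0) (suc (suc m))) (marks n (P ∘ suc) ⌊ suc (suc m) /2⌋)) (∈-map⁺ _ mem)

∈-marks⁻ : ∀ {n P m q} → q ∈ marks (suc n) P (suc (suc m)) →
  (Σ Mark λ q′ → q′ ∈ marks n (P ∘ suc) ⌊ suc (suc m) /2⌋ × q ≡ extend₀ (P 0) (suc (suc m)) q′) ⊎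
  (Σ Mark λ q′ → q′ ∈ marks n (P ∘ suc) ⌈ suc (suc m) /2⌉ × q ≡ extend₁ (P 0) (suc (suc m)) q′)
∈-marks⁻ {n} {P} {m} mem =
  Sum.map (∈-map⁻ _) (∈-map⁻ _)
    (∈-++⁻ (map (extend₀ (P 0) (suc (suc m))) (marks n (P ∘ suc) ⌊ suc (suc m) /2⌋)) mem)

module _ {a : ℤ → Sign} (U : Unfolding a) where
  open Unfolding U

  class-hits : ∀ s → Σ ℤ λ j → a (position class j) ≡ s
  class-hits s = bit q , trans (value (bit q)) (trans (cong (signed sign) (parity-bit q)) signed≡)
    where
    q       = proj₁ (signed-surjective sign s)
    signed≡ = proj₂ (signed-surjective sign s)

-- In a complete folding sequence each sign occurs at positions of either parity:
-- on the alternating class directly, on the other class via the derived sequence.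
letter-occurs : ∀ {a} (complete : CompleteFolding a) p s → Occurrence a 1 (p , s ∷ [])
letter-occurs complete p s with p Bool.≟ Unfolding.class (unfold complete)
... | yes refl = position p j , parity-position p j , cong (_∷ []) (sym a≡)
  where
  j  = proj₁ (class-hits (unfold complete) s)
  a≡ = proj₂ (class-hits (unfold complete) s)
... | no p≢c = sucℤ (position c j) , parity≡ , cong (_∷ []) (sym a≡)
  where
  U  = unfold complete
  c  = Unfolding.class U
  U′ = unfold (next-complete complete)
  j  = position (Unfolding.class U′) (proj₁ (class-hits U′ s))
  a≡ = proj₂ (class-hits U′ s)
  parity≡ : parity (sucℤ (position c j)) ≡ p
  parity≡ = trans (parity-suc (position c j))
                  (trans (cong not (parity-position c j)) (sym (¬-not p≢c)))

module _ {a : ℤ → Sign} (complete : CompleteFolding a) where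
  open Unfolding (unfold complete) using (class; sign; value)
  open Weaving a class sign value

  parity-odd : ∀ j → parity (sucℤ (position class j)) ≡ not class
  parity-odd j = trans (parity-suc (position class j)) (cong not (parity-position class j))

  lift₀ : ∀ M {q} → Occurrence (derived a class) ⌊ M /2⌋ q →
          Occurrence a M (extend₀ (class , sign) M q)
  lift₀ M (j , refl , refl) = position class j , parity-position class j , sym (window-even M j)

  lift₁ : ∀ M {q} → Occurrence (derived a class) ⌈ M /2⌉ q →
          Occurrence a M (extend₁ (class , sign) M q)
  lift₁ M (j , refl , refl) = sucℤ (position class j) , parity-odd j , sym (window-odd M j)

  window-unfold : ∀ M k → Σ ℤ λ j →
    (parity k , window a k M) ≡
      extend₀ (class , sign) M (parity j , window (derived a class) j ⌊ M /2⌋) ⊎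
    (parity k , window a k M) ≡
      extend₁ (class , sign) M (parity j , window (derived a class) j ⌈ M /2⌉)
  window-unfold M k with position-cover class k
  ... | j , inj₁ refl = j , inj₁ (cong₂ _,_ (parity-position class j) (window-even M j))
  ... | j , inj₂ refl =
    j , inj₂ (cong₂ _,_ (parity-odd j) (window-odd M j))

marks-sound : ∀ n m → m ≤ n → ∀ {a} (complete : CompleteFolding a) {q} →
              q ∈ marks n (unfoldings a complete) m → Occurrence a m q
marks-sound n zero _ complete (here refl)         = bit false , refl , refl
marks-sound n zero _ complete (there (here refl)) = bit true  , refl , refl
marks-sound n (suc zero) _ complete (here refl) = letter-occurs complete false ⊕
marks-sound n (suc zero) _ complete (there (here refl)) = letter-occurs complete false ⊖
marks-sound n (suc zero) _ complete (there (there (here refl))) = letter-occurs complete true ⊕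
marks-sound n (suc zero) _ complete (there (there (there (here refl)))) =
  letter-occurs complete true ⊖
marks-sound (suc n) (suc (suc m)) le {a} complete mem
  with ∈-marks⁻ {n} {unfoldings a complete} {m} mem
... | inj₁ (_ , mem′ , refl) =
  lift₀ complete (suc (suc m))
    (marks-sound n _ (proj₁ (halves-fit le)) (next-complete complete) mem′)
... | inj₂ (_ , mem′ , refl) =
  lift₁ complete (suc (suc m))
    (marks-sound n _ (proj₂ (halves-fit le)) (next-complete complete) mem′)

marks-complete : ∀ n m → m ≤ n → ∀ {a} (complete : CompleteFolding a) {q} →
                 Occurrence a m q → q ∈ marks n (unfoldings a complete) m
marks-complete n zero       _ {a} complete (k , refl , refl) =
  empty-mark {n} {unfoldings a complete} (parity k)
marks-complete n (suc zero) _ {a} complete (k , refl , refl) =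
  letter-mark {n} {unfoldings a complete} (parity k) (a k)
marks-complete (suc n) (suc (suc m)) le {a} complete (k , refl , refl)
  with window-unfold complete _ k
... | j , inj₁ eq = subst (_∈ marks (suc n) (unfoldings a complete) (suc (suc m))) (sym eq)
  (∈-marks⁺₀ {n} {unfoldings a complete} {m} (marks-complete n ⌊ suc (suc m) /2⌋
    (proj₁ (halves-fit le)) (next-complete complete) (j , refl , refl)))
... | j , inj₂ eq = subst (_∈ marks (suc n) (unfoldings a complete) (suc (suc m))) (sym eq)
  (∈-marks⁺₁ {n} {unfoldings a complete} {m} (marks-complete n ⌈ suc (suc m) /2⌉
    (proj₂ (halves-fit le)) (next-complete complete) (j , refl , refl)))

_≟ʷ_ : DecidableEquality (List Sign)
_≟ʷ_ = ≡-dec _≟ˢ_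

words : (ℕ → Param) → ℕ → List (List Sign)
words P t = map proj₂ (marks t P t)

distinctWords : (ℕ → Param) → ℕ → List (List Sign)
distinctWords P t = deduplicate _≟ʷ_ (words P t)

Bool-≡-by : ∀ {x y : Bool} c → (x ≡ c → y ≡ c) → (y ≡ c → x ≡ c) → x ≡ y
Bool-≡-by {false} {false} c     _ _ = refl
Bool-≡-by {true}  {true}  c     _ _ = refl
Bool-≡-by {false} {true}  false f _ = sym (f refl)
Bool-≡-by {false} {true}  true  _ g = g refl
Bool-≡-by {true}  {false} false _ g = g refl
Bool-≡-by {true}  {false} true  f _ = sym (f refl)

module Counting {a : ℤ → Sign} (complete : CompleteFolding a) where
  open Unfolding (unfold complete) using (class; anchor-iff)

  P : ℕ → Param
  P = unfoldings a complete

  words-spec : ∀ t w → w ∈ words P t ⇔ (length w ≡ t × SubwordZ w a)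
  words-spec t w = mk⇔ to from
    where
    to : w ∈ words P t → length w ≡ t × SubwordZ w a
    to mem with ∈-map⁻ proj₂ mem
    ... | _ , mark∈ , refl with marks-sound t t ≤-refl complete mark∈
    ...   | k , _ , refl = length-window a k t , k , cong (window a k) (sym (length-window a k t))
    from : length w ≡ t × SubwordZ w a → w ∈ words P t
    from (refl , h , w≡) = ∈-map⁺ proj₂ (marks-complete t t ≤-refl complete (h , refl , w≡))

  -- A word of length t ≥ 7 determines the parity of its starting positions: its
  -- first 7 letters tell whether it starts at an anchor, i.e. in the class `class`.
  parity-determined : ∀ {t k k′} → 7 ≤ t → window a k t ≡ window a k′ t → parity k ≡ parity k′
  parity-determined {t} {k} {k′} le eq = Bool-≡-by class
    (Equivalence.to (anchor-iff k′) ∘ subst id same-anchor ∘ Equivalence.from (anchor-iff k))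
    (Equivalence.to (anchor-iff k) ∘ subst id (sym same-anchor) ∘ Equivalence.from (anchor-iff k′))
    where
    same-anchor : Anchor a k ≡ Anchor a k′
    same-anchor = cong (Alternating ∘ pick false)
      (trans (sym (take-window a k le)) (trans (cong (take 7) eq) (take-window a k′ le)))

  -- For t ≥ 7 the listed marks are determined by their words, so there are 4t words.
  count-long : ∀ t → 7 ≤ t → SubwordCount a t (4 * t)
  count-long t le = words P t , unique , length≡ , words-spec t
    where
    G = marks t P t
    word-determines-mark : ∀ {q q′} → q ∈ G → q′ ∈ G → proj₂ q ≡ proj₂ q′ → q ≡ q′
    word-determines-mark {p , w} {p′ , _} q∈ q′∈ refl
      with marks-sound t t ≤-refl complete q∈ | marks-sound t t ≤-refl complete q′∈
    ... | k , refl , w≡ | k′ , refl , w≡′ = cong (_, w) (parity-determined le (trans (sym w≡) w≡′))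
    unique : Unique (words P t)
    unique = Unique-map proj₂ word-determines-mark (marks-unique t P t ≤-refl)
    length≡ : length (words P t) ≡ 4 * t
    length≡ = trans (length-map proj₂ G) (marks-length t P t (≤-trans (s≤s z≤n) le) ≤-refl)

  count-short : ∀ t N → length (distinctWords P t) ≡ N → SubwordCount a t N
  count-short t N len =
    distinctWords P t , UniqueDec.deduplicate-! _≟ʷ_ (words P t) , len ,
    λ w → ⇔-trans (⇔-sym (deduplicate-∈⇔ _≟ʷ_)) (words-spec t w)

-- Words of length t ≤ 6 need at most three unfolding steps, so the number of
-- distinct ones depends only on P 0, P 1, P 2; it is evaluated for all 64 choices.
SmallCounts : (ℕ → Param) → Set
SmallCounts P =
  length (distinctWords P 1) ≡ 2  × length (distinctWords P 2) ≡ 4 ×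
  length (distinctWords P 3) ≡ 8  × length (distinctWords P 4) ≡ 12 ×
  length (distinctWords P 5) ≡ 18 × length (distinctWords P 6) ≡ 23

smallCounts? : ∀ P → Dec (SmallCounts P)
smallCounts? P =
  (length (distinctWords P 1) ℕ.≟ 2)  ×-dec (length (distinctWords P 2) ℕ.≟ 4) ×-dec
  (length (distinctWords P 3) ℕ.≟ 8)  ×-dec (length (distinctWords P 4) ℕ.≟ 12) ×-dec
  (length (distinctWords P 5) ℕ.≟ 18) ×-dec (length (distinctWords P 6) ℕ.≟ 23)

firstThree : Param → Param → Param → ℕ → Param
firstThree x y z zero          = x
firstThree x y z (suc zero)    = y
firstThree x y z (suc (suc _)) = z

∀-Param? : {Q : Param → Set} → (∀ x → Dec (Q x)) → Dec (∀ x → Q x)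
∀-Param? {Q} Q? =
  map′ every (λ h → h (false , ⊕) , h (false , ⊖) , h (true , ⊕) , h (true , ⊖))
       (Q? (false , ⊕) ×-dec Q? (false , ⊖) ×-dec Q? (true , ⊕) ×-dec Q? (true , ⊖))
  where
  every : Q (false , ⊕) × Q (false , ⊖) × Q (true , ⊕) × Q (true , ⊖) → ∀ x → Q x
  every (q , _ , _ , _) (false , ⊕) = q
  every (_ , q , _ , _) (false , ⊖) = q
  every (_ , _ , q , _) (true  , ⊕) = q
  every (_ , _ , _ , q) (true  , ⊖) = q

smallCounts-firstThree : ∀ x y z → SmallCounts (firstThree x y z)
smallCounts-firstThree = toWitness
  {a? = ∀-Param? λ x → ∀-Param? λ y → ∀-Param? λ z → smallCounts? (firstThree x y z)} tt

-- SmallCounts P and SmallCounts (firstThree (P 0) (P 1) (P 2)) agree by computation.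
smallCounts : ∀ P → SmallCounts P
smallCounts P = smallCounts-firstThree (P 0) (P 1) (P 2)

theorem1p8 : (a : ℤ → Sign) → CompleteFolding a →
    ((t : ℕ) → 7 ≤ t → SubwordCount a t (4 * t)) ×
    SubwordCount a 1 2 × SubwordCount a 2 4 × SubwordCount a 3 8 ×
    SubwordCount a 4 12 × SubwordCount a 5 18 × SubwordCount a 6 23
theorem1p8 a complete =
  let open Counting complete
      (c₁ , c₂ , c₃ , c₄ , c₅ , c₆) = smallCounts P
  in count-long ,
     count-short 1 2 c₁ , count-short 2 4 c₂ , count-short 3 8 c₃ ,
     count-short 4 12 c₄ , count-short 5 18 c₅ , count-short 6 23 c₆
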